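{- Let $\Theta$ be a variety of universal algebras and let $H$ be a free $\Theta$-algebra with a finite set of free generators. If $H$ is weakly homogeneous, then $H$ is logically perfect.
   Context: An algebra $H$ is weakly homogeneous if for every isomorphism $\varphi:A\to B$ between two finitely generated subalgebras $A,B$ of $H$ such that $\varphi$ extends to an endomorphism of $H$ and $\varphi^{ -1}:B\to A$ also extends to an endomorphism of $H$, the map $\varphi$ extends to an automorphism of $H$. Let $X^0=\{x_1,x_2,\dots\}$ be a countable set of variables and for finite $X\subset X^0$ let $W(X)$ be the free $\Theta$-algebra on $X$; a homomorphism $\mu:W(X)\to H$ is called a point. Formulas of sort $X$, $\Phi(X)$, are defined inductively over all finite $X$: equalities $w\equiv w'$ ($w,w'\in W(X)$) are in $\Phi(X)$; $\Phi(X)$ is closed under $\neg$, $\vee$, $\wedge$ and $\exists x$ for $x\in X$; if $u\in\Phi(X)$ and $s:W(X)\to W(Y)$ is a homomorphism then $s_*u\in\Phi(Y)$. The value $Val^X_H(u)\subseteq\mathrm{Hom}(W(X),H)$: $Val^X_H(w\equiv w')=\{\mu:\mu(w)=\mu(w')\}$; $\mu\in Val^X_H(\exists x\,u)$ iff some point $\nu$ agreeing with $\mu$ on $X\setminus\{x\}$ lies in $Val^X_H(u)$; $\neg,\vee,\wedge$ are complement, union, intersection; $\mu\in Val^Y_H(s_*v)$ iff $\mu\circ s\in Val^X_H(v)$. The logical kernel of a point $\mu:W(X)\to H$ is $LKer(\mu)=\{u\in\Phi(X):\mu\in Val^X_H(u)\}$. $H$ is logically perfect if for every finite $X$ and every two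 points $\mu,\nu:W(X)\to H$ with $LKer(\mu)=LKer(\nu)$ there is an automorphism $\varphi$ of $H$ with $\mu=\varphi\circ\nu$. -}

module Defs where

open import Level using (0ℓ)
open import Data.Nat using (ℕ)
open import Data.Fin using (Fin)
open import Data.Product using (Σ; _×_; _,_; proj₁; proj₂)
open import Data.Sum using (_⊎_)
open import Relation.Nullary using (¬_)
open import Relation.Binary.PropositionalEquality using (_≢_)
open import Relation.Binary.Structures using (IsEquivalence)

record Signature : Set₁ where
  field
    Op    : Set
    arity : Op → ℕ

module _ (S : Signature) where
  open Signature S

  data Term (V : Set) : Set where
    var : V → Term V
    op  : (f : Op) → (Fin (arity f) → Term V) → Term V

  record Algebra : Set₁ where
    field
      Carrier : Set
      _≈_     : Carrier → Carrier → Set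
      isEquiv : IsEquivalence _≈_
      ⟦_⟧     : (f : Op) → (Fin (arity f) → Carrier) → Carrier
      ⟦⟧-cong : ∀ f {as bs : Fin (arity f) → Carrier} →
                (∀ i → as i ≈ bs i) → ⟦ f ⟧ as ≈ ⟦ f ⟧ bs

  open Algebra

  eval : (A : Algebra) {V : Set} → (V → Carrier A) → Term V → Carrier A
  eval A ρ (var x)   = ρ x
  eval A ρ (op f ts) = ⟦ A ⟧ f (λ i → eval A ρ (ts i))

  record Hom (A B : Algebra) : Set where
    field
      fun   : Carrier A → Carrier B
      cong  : ∀ {x y} → _≈_ A x y → _≈_ B (fun x) (fun y)
      homo  : ∀ f (as : Fin (arity f) → Carrier A) →
              _≈_ B (fun (⟦ A ⟧ f as)) (⟦ B ⟧ f (λ i → fun (as i)))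

  open Hom

  _∘ₕ_ : {A B C : Algebra} → Hom B C → Hom A B → Hom A C
  _∘ₕ_ {A} {B} {C} g h = record
    { fun  = λ x → fun g (fun h x)
    ; cong = λ p → cong g (cong h p)
    ; homo = λ f as → IsEquivalence.trans (isEquiv C)
                        (cong g (homo h f as)) (homo g f (λ i → fun h (as i)))
    }

  record Iso (A B : Algebra) : Set where
    field
      to      : Hom A B
      from    : Hom B A
      to-from : ∀ b → _≈_ B (fun to (fun from b)) b
      from-to : ∀ a → _≈_ A (fun from (fun to a)) a

  Aut : Algebra → Set
  Aut H = Iso H H

  InSg : (H : Algebra) {k : ℕ} → (Fin k → Carrier H) → Carrier H → Set
  InSg H {k} g a = Σ (Term (Fin k)) λ t → _≈_ H a (eval H g t)

  SubAlg : (H : Algebra) {k : ℕ} → (Fin k → Carrier H) → Algebra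
  SubAlg H {k} g = record
    { Carrier = Σ (Carrier H) (InSg H g)
    ; _≈_     = λ a b → _≈_ H (proj₁ a) (proj₁ b)
    ; isEquiv = record
        { refl  = IsEquivalence.refl (isEquiv H)
        ; sym   = IsEquivalence.sym (isEquiv H)
        ; trans = IsEquivalence.trans (isEquiv H) }
    ; ⟦_⟧     = λ f as →
        ( ⟦ H ⟧ f (λ i → proj₁ (as i))
        , op f (λ i → proj₁ (proj₂ (as i)))
        , ⟦⟧-cong H f (λ i → proj₂ (proj₂ (as i))) )
    ; ⟦⟧-cong = λ f p → ⟦⟧-cong H f p
    }

  WeaklyHomogeneous : Algebra → Set
  WeaklyHomogeneous H =
    ∀ {k l : ℕ} (g : Fin k → Carrier H) (h : Fin l → Carrier H)
      (φ : Iso (SubAlg H g) (SubAlg H h)) →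
      Σ (Hom H H) (λ e → ∀ a → _≈_ H (fun e (proj₁ a)) (proj₁ (fun (Iso.to φ) a))) →
      Σ (Hom H H) (λ e → ∀ b → _≈_ H (fun e (proj₁ b)) (proj₁ (fun (Iso.from φ) b))) →
      Σ (Aut H) (λ α → ∀ a → _≈_ H (fun (Iso.to α) (proj₁ a)) (proj₁ (fun (Iso.to φ) a)))

  -- Varieties: a variety Θ is given by a set E of identities in the
  -- countably many variables X⁰ = {x₀, x₁, …} (indexed by ℕ).

  Identities : Set₁
  Identities = Term ℕ → Term ℕ → Set

  InVariety : Identities → Algebra → Set
  InVariety E A = ∀ s t → E s t → ∀ (ρ : ℕ → Carrier A) → _≈_ A (eval A ρ s) (eval A ρ t)

  IsFreeFinitelyGenerated : Identities → Algebra → Set₁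
  IsFreeFinitelyGenerated E H =
    InVariety E H ×
    Σ ℕ λ n → Σ (Fin n → Carrier H) λ gen →
      ∀ (B : Algebra) → InVariety E B → (f : Fin n → Carrier B) →
        Σ (Hom H B) (λ h → ∀ i → _≈_ B (fun h (gen i)) (f i)) ×
        (∀ (h h' : Hom H B) → (∀ i → _≈_ B (fun h (gen i)) (fun h' (gen i))) →
           ∀ x → _≈_ B (fun h x) (fun h' x))

  -- The free Θ-algebra W(X) on X = {x₀,…,x_{n-1}}: terms modulo
  -- derivability from E (Birkhoff's equational logic).

  subst : {V : Set} → (ℕ → Term V) → Term ℕ → Term V
  subst σ (var x)   = σ x
  subst σ (op f ts) = op f (λ i → subst σ (ts i))

  data Derives (E : Identities) {V : Set} : Term V → Term V → Set where
    axiom : ∀ {s t} → E s t → (σ : ℕ → Term V) → Derives E (subst σ s) (subst σ t)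
    drefl  : ∀ {t} → Derives E t t
    dsym   : ∀ {s t} → Derives E s t → Derives E t s
    dtrans : ∀ {s t u} → Derives E s t → Derives E t u → Derives E s u
    dcong  : ∀ f {ss ts : Fin (arity f) → Term V} →
             (∀ i → Derives E (ss i) (ts i)) → Derives E (op f ss) (op f ts)

  W : Identities → ℕ → Algebra
  W E n = record
    { Carrier = Term (Fin n)
    ; _≈_     = Derives E
    ; isEquiv = record { refl = drefl ; sym = dsym ; trans = dtrans }
    ; ⟦_⟧     = op
    ; ⟦⟧-cong = dcong
    }

  data Formula (E : Identities) : ℕ → Set where
    _≐_  : ∀ {n} → Term (Fin n) → Term (Fin n) → Formula E n
    ¬ᶠ_  : ∀ {n} → Formula E n → Formula E n
    _∨ᶠ_ : ∀ {n} → Formula E n → Formula E n → Formula E n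
    _∧ᶠ_ : ∀ {n} → Formula E n → Formula E n → Formula E n
    ∃ᶠ   : ∀ {n} → Fin n → Formula E n → Formula E n
    _*ᶠ_ : ∀ {m n} → Hom (W E m) (W E n) → Formula E m → Formula E n

  Point : Identities → ℕ → Algebra → Set
  Point E n H = Hom (W E n) H

  Val : (E : Identities) (H : Algebra) {n : ℕ} → Formula E n → Point E n H → Set
  Val E H (w ≐ w')  μ = _≈_ H (fun μ w) (fun μ w')
  Val E H (¬ᶠ u)    μ = ¬ Val E H u μ
  Val E H (u ∨ᶠ v)  μ = Val E H u μ ⊎ Val E H v μ
  Val E H (u ∧ᶠ v)  μ = Val E H u μ × Val E H v μ
  Val E H {n} (∃ᶠ x u) μ =
    Σ (Point E n H) λ ν →
      (∀ (y : Fin n) → y ≢ x → _≈_ H (fun ν (var y)) (fun μ (var y))) × Val E H u ν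
  Val E H (s *ᶠ u)  μ = Val E H u (μ ∘ₕ s)

  SameLKer : (E : Identities) (H : Algebra) {n : ℕ} → Point E n H → Point E n H → Set
  SameLKer E H {n} μ ν = ∀ (u : Formula E n) → (Val E H u μ → Val E H u ν) × (Val E H u ν → Val E H u μ)

  LogicallyPerfect : Identities → Algebra → Set
  LogicallyPerfect E H =
    ∀ (n : ℕ) (μ ν : Point E n H) → SameLKer E H μ ν →
      Σ (Aut H) λ φ → ∀ (w : Term (Fin n)) → _≈_ H (fun μ w) (fun (Iso.to φ) (fun ν w))

module Submission where

-- Let μ, ν : W(X) → H be points with the same logical kernel, and write
-- aᵢ = μ(xᵢ), bᵢ = ν(xᵢ).  Since H is generated by the gⱼ, aᵢ = tᵢ(g) for
-- terms tᵢ, so μ satisfies the "image formula" ∃y₁…yₘ ⋀ᵢ xᵢ ≡ tᵢ(y).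
-- Hence so does ν: bᵢ = tᵢ(c) for some c, and the endomorphism gⱼ ↦ cⱼ
-- (freeness) sends every aᵢ to bᵢ.  Symmetrically some endomorphism sends
-- every bᵢ to aᵢ.  Because the kernels agree on equalities, t(b) ↦ t(a) is
-- a well defined isomorphism φ between the subalgebras generated by b and
-- by a, and the two endomorphisms extend φ and φ⁻¹.  Weak homogeneity then
-- extends φ to an automorphism α with μ = α ∘ ν.

open import Defs
open import Level using (0ℓ)
open import Data.Nat using (ℕ; zero; suc; _+_)
open import Data.Fin using (Fin; zero; suc; _↑ˡ_; _↑ʳ_; splitAt; _≟_)
open import Data.Fin.Properties using (splitAt-↑ˡ; splitAt-↑ʳ; splitAt⁻¹-↑ˡ; splitAt⁻¹-↑ʳ)
open import Data.Vec.Functional using (_++_)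
open import Data.Vec.Functional.Properties using (lookup-++ˡ; lookup-++ʳ)
open import Data.Product using (Σ; _×_; _,_; proj₁; proj₂)
open import Data.Sum using (_⊎_; inj₁; inj₂)
open import Data.Empty using (⊥-elim)
open import Function using (_∘_)
open import Relation.Nullary using (Dec; yes; no)
open import Relation.Binary.Bundles using (Setoid)
open import Relation.Binary.PropositionalEquality as ≡ using (_≡_; _≢_)
import Relation.Binary.Reasoning.Setoid as SetoidReasoning

setoidOf : {S : Signature} → Algebra S → Setoid 0ℓ 0ℓ
setoidOf A = record { isEquivalence = Algebra.isEquiv A }

idHom : {S : Signature} (A : Algebra S) → Hom S A A
idHom A = record { fun = λ x → x ; cong = λ p → p ; homo = λ f as → Setoid.refl (setoidOf A) }

↑-cases : {n m : ℕ} (z : Fin (n + m)) →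
          Σ (Fin n) (λ i → z ≡ i ↑ˡ m) ⊎ Σ (Fin m) (λ j → z ≡ n ↑ʳ j)
↑-cases {n} z with splitAt n z in eq
... | inj₁ i = inj₁ (i , ≡.sym (splitAt⁻¹-↑ˡ eq))
... | inj₂ j = inj₂ (j , ≡.sym (splitAt⁻¹-↑ʳ eq))

↑ˡ≢↑ʳ : {n m : ℕ} (i : Fin n) (j : Fin m) → i ↑ˡ m ≢ n ↑ʳ j
↑ˡ≢↑ʳ {n} {m} i j eq
  with ≡.trans (≡.sym (splitAt-↑ˡ n i m)) (≡.trans (≡.cong (splitAt n) eq) (splitAt-↑ʳ n m j))
... | ()

module Substitution (S : Signature) (E : Identities S) where

  bind : {U V : Set} → (U → Term S V) → Term S U → Term S V
  bind σ (var x)   = σ x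
  bind σ (op f ts) = op f (λ i → bind σ (ts i))

  bind-subst : {U V : Set} (σ : U → Term S V) (τ : ℕ → Term S U) (s : Term S ℕ) →
               Derives S E (bind σ (subst S τ s)) (subst S (bind σ ∘ τ) s)
  bind-subst σ τ (var x)   = drefl
  bind-subst σ τ (op f ts) = dcong f (λ i → bind-subst σ τ (ts i))

  bind-derives : {U V : Set} (σ : U → Term S V) {s t : Term S U} →
                 Derives S E s t → Derives S E (bind σ s) (bind σ t)
  bind-derives σ (axiom {s} {t} e τ) =
    dtrans (bind-subst σ τ s) (dtrans (axiom e (bind σ ∘ τ)) (dsym (bind-subst σ τ t)))
  bind-derives σ drefl         = drefl
  bind-derives σ (dsym d)      = dsym (bind-derives σ d)
  bind-derives σ (dtrans d d') = dtrans (bind-derives σ d) (bind-derives σ d')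
  bind-derives σ (dcong f ds)  = dcong f (λ i → bind-derives σ (ds i))

  substHom : {a b : ℕ} → (Fin a → Term S (Fin b)) → Hom S (W S E a) (W S E b)
  substHom σ = record { fun = bind σ ; cong = bind-derives σ ; homo = λ f as → drefl }

module Evaluation (S : Signature) where

  module _ (A : Algebra S) where
    open Algebra A
    private module A≈ = Setoid (setoidOf A)

    eval-cong : {V : Set} {ρ ρ' : V → Carrier} → (∀ x → ρ x ≈ ρ' x) →
                ∀ t → eval S A ρ t ≈ eval S A ρ' t
    eval-cong p (var x)   = p x
    eval-cong p (op f ts) = ⟦⟧-cong f (λ i → eval-cong p (ts i))

    eval-subst : {V : Set} (ρ : V → Carrier) (σ : ℕ → Term S V) (s : Term S ℕ) →
                 eval S A ρ (subst S σ s) ≈ eval S A (eval S A ρ ∘ σ) s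
    eval-subst ρ σ (var x)   = A≈.refl
    eval-subst ρ σ (op f ts) = ⟦⟧-cong f (λ i → eval-subst ρ σ (ts i))

    eval-sound : {E : Identities S} → InVariety S E A → {V : Set} (ρ : V → Carrier)
                 {s t : Term S V} → Derives S E s t → eval S A ρ s ≈ eval S A ρ t
    eval-sound A∈Θ ρ (axiom {s} {t} e σ) =
      A≈.trans (eval-subst ρ σ s) (A≈.trans (A∈Θ s t e (eval S A ρ ∘ σ)) (A≈.sym (eval-subst ρ σ t)))
    eval-sound A∈Θ ρ drefl         = A≈.refl
    eval-sound A∈Θ ρ (dsym d)      = A≈.sym (eval-sound A∈Θ ρ d)
    eval-sound A∈Θ ρ (dtrans d d') = A≈.trans (eval-sound A∈Θ ρ d) (eval-sound A∈Θ ρ d')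
    eval-sound A∈Θ ρ (dcong f ds)  = ⟦⟧-cong f (λ i → eval-sound A∈Θ ρ (ds i))

  hom-eval : {A B : Algebra S} (h : Hom S A B) {V : Set} (ρ : V → Algebra.Carrier A) →
             ∀ t → Algebra._≈_ B (Hom.fun h (eval S A ρ t)) (eval S B (Hom.fun h ∘ ρ) t)
  hom-eval {B = B} h ρ (var x)   = Setoid.refl (setoidOf B)
  hom-eval {B = B} h ρ (op f ts) =
    Setoid.trans (setoidOf B) (Hom.homo h f _) (Algebra.⟦⟧-cong B f (λ i → hom-eval h ρ (ts i)))

  module _ (E : Identities S) where

    eval-var : {n : ℕ} (t : Term S (Fin n)) → Derives S E (eval S (W S E n) var t) t
    eval-var (var x)   = drefl
    eval-var (op f ts) = dcong f (λ i → eval-var (ts i))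

    point-eval : {A : Algebra S} {n : ℕ} (p : Point S E n A) (t : Term S (Fin n)) →
                 Algebra._≈_ A (Hom.fun p t) (eval S A (Hom.fun p ∘ var) t)
    point-eval {A} p t =
      Setoid.trans (setoidOf A) (Hom.cong p (dsym (eval-var t))) (hom-eval p var t)

    pointOf : {A : Algebra S} {n : ℕ} → InVariety S E A → (Fin n → Algebra.Carrier A) → Point S E n A
    pointOf {A} A∈Θ ρ = record
      { fun = eval S A ρ ; cong = eval-sound A A∈Θ ρ ; homo = λ f as → Setoid.refl (setoidOf A) }

-- The subalgebra generated by finitely many elements of an algebra of Θ
-- lies in Θ (its inclusion is a homomorphism commuting with evaluation).
SubAlg-∈ : (S : Signature) (E : Identities S) (H : Algebra S) → InVariety S E H →
           {k : ℕ} (g : Fin k → Algebra.Carrier H) → InVariety S E (SubAlg S H g)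
SubAlg-∈ S E H H∈Θ g s t e ρ =
  trans (hom-eval inclusion ρ s) (trans (H∈Θ s t e (proj₁ ∘ ρ)) (sym (hom-eval inclusion ρ t)))
  where
  open Setoid (setoidOf H)
  open Evaluation S
  inclusion : Hom S (SubAlg S H g) H
  inclusion = record { fun = proj₁ ; cong = λ p → p ; homo = λ f as → refl }

FreeOn : (S : Signature) (E : Identities S) (H : Algebra S) {m : ℕ} →
         (Fin m → Algebra.Carrier H) → Set₁
FreeOn S E H {m} gen =
  ∀ (B : Algebra S) → InVariety S E B → (f : Fin m → Algebra.Carrier B) →
    Σ (Hom S H B) (λ h → ∀ i → Algebra._≈_ B (Hom.fun h (gen i)) (f i)) ×
    (∀ (h h' : Hom S H B) → (∀ i → Algebra._≈_ B (Hom.fun h (gen i)) (Hom.fun h' (gen i))) →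
       ∀ x → Algebra._≈_ B (Hom.fun h x) (Hom.fun h' x))

module FreeAlgebra (S : Signature) (E : Identities S) (H : Algebra S) (H∈Θ : InVariety S E H)
                   {m : ℕ} (gen : Fin m → Algebra.Carrier H) (universal : FreeOn S E H gen) where
  open Setoid (setoidOf H)

  extend : (c : Fin m → Carrier) → Σ (Hom S H H) λ e → ∀ j → Hom.fun e (gen j) ≈ c j
  extend c = proj₁ (universal H H∈Θ c)

  -- The map H → SubAlg(gen) fixing the generators, composed with the
  -- inclusion, agrees with the identity on the generators, hence everywhere.
  generated : ∀ x → Σ (Term S (Fin m)) λ t → x ≈ eval S H gen t
  generated x = proj₁ (proj₂ (Hom.fun toSub x)) , trans x≈toSub (proj₂ (proj₂ (Hom.fun toSub x)))
    where
    Sg : Algebra S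
    Sg = SubAlg S H gen
    toSub-spec : Σ (Hom S H Sg) λ h → ∀ i → proj₁ (Hom.fun h (gen i)) ≈ gen i
    toSub-spec = proj₁ (universal Sg (SubAlg-∈ S E H H∈Θ gen) (λ i → gen i , var i , refl))
    toSub : Hom S H Sg
    toSub = proj₁ toSub-spec
    round-trip : Hom S H H
    round-trip = record { fun = proj₁ ∘ Hom.fun toSub ; cong = Hom.cong toSub ; homo = Hom.homo toSub }
    x≈toSub : x ≈ proj₁ (Hom.fun toSub x)
    x≈toSub = proj₂ (universal H H∈Θ gen) (idHom H) round-trip (λ i → sym (proj₂ toSub-spec i)) x

module Semantics (S : Signature) (E : Identities S) (H : Algebra S)
                 (H∈Θ : InVariety S E H) where
  open Algebra H using (Carrier; _≈_)
  open Setoid (setoidOf H) using (refl; sym; trans; reflexive)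
  open Evaluation S
  open Hom

  Pt : ℕ → Set
  Pt n = Point S E n H

  _⊨_ : {n : ℕ} → Pt n → Formula S E n → Set
  μ ⊨ u = Val S E H u μ

  val-resp : {n : ℕ} (u : Formula S E n) (μ ν : Pt n) →
             (∀ t → fun μ t ≈ fun ν t) → μ ⊨ u → ν ⊨ u
  val-resp (w ≐ w')  μ ν p h       = trans (sym (p w)) (trans h (p w'))
  val-resp (¬ᶠ u)    μ ν p h ν⊨u   = h (val-resp u ν μ (sym ∘ p) ν⊨u)
  val-resp (u ∨ᶠ u') μ ν p (inj₁ h) = inj₁ (val-resp u μ ν p h)
  val-resp (u ∨ᶠ u') μ ν p (inj₂ h) = inj₂ (val-resp u' μ ν p h)
  val-resp (u ∧ᶠ u') μ ν p (h , h') = val-resp u μ ν p h , val-resp u' μ ν p h'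
  val-resp (∃ᶠ x u)  μ ν p (κ , κ≈μ , h) = κ , (λ y y≢x → trans (κ≈μ y y≢x) (p (var y))) , h
  val-resp (s *ᶠ u)  μ ν p h       = val-resp u (_∘ₕ_ S μ s) (_∘ₕ_ S ν s) (p ∘ fun s) h

  val-resp-vars : {n : ℕ} (u : Formula S E n) (μ ν : Pt n) →
                  (∀ x → fun μ (var x) ≈ fun ν (var x)) → μ ⊨ u → ν ⊨ u
  val-resp-vars u μ ν p = val-resp u μ ν λ t →
    trans (point-eval E μ t) (trans (eval-cong H p t) (sym (point-eval E ν t)))

  ∃⃗ : {n k : ℕ} → (Fin k → Fin n) → Formula S E n → Formula S E n
  ∃⃗ {k = zero}  v u = u
  ∃⃗ {k = suc k} v u = ∃ᶠ (v zero) (∃⃗ (v ∘ suc) u)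

  AgreeOff : {n k : ℕ} → (Fin k → Fin n) → Pt n → Pt n → Set
  AgreeOff {n} v κ μ = ∀ (z : Fin n) → (∀ j → z ≢ v j) → fun κ (var z) ≈ fun μ (var z)

  ∃⃗-elim : {n k : ℕ} (v : Fin k → Fin n) (u : Formula S E n) (μ : Pt n) →
           μ ⊨ ∃⃗ v u → Σ (Pt n) λ κ → AgreeOff v κ μ × κ ⊨ u
  ∃⃗-elim {k = zero}  v u μ h = μ , (λ z _ → refl) , h
  ∃⃗-elim {k = suc k} v u μ (κ₀ , κ₀≈μ , h) with ∃⃗-elim (v ∘ suc) u κ₀ h
  ... | κ , κ≈κ₀ , κ⊨u = κ , (λ z z∉v → trans (κ≈κ₀ z (z∉v ∘ suc)) (κ₀≈μ z (z∉v zero))) , κ⊨u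

  update : {n : ℕ} → Fin n → (Fin n → Carrier) → (Fin n → Carrier) → Fin n → Carrier
  update y a b z with z ≟ y
  ... | yes _ = a z
  ... | no  _ = b z

  update-at : {n : ℕ} (y : Fin n) (a b : Fin n → Carrier) → update y a b y ≈ a y
  update-at y a b with y ≟ y
  ... | yes _   = refl
  ... | no  y≢y = ⊥-elim (y≢y ≡.refl)

  update-off : {n : ℕ} (y : Fin n) (a b : Fin n → Carrier) (z : Fin n) → z ≢ y → update y a b z ≈ b z
  update-off y a b z z≢y with z ≟ y
  ... | yes z≡y = ⊥-elim (z≢y z≡y)
  ... | no  _   = refl

  -- Witnesses for the quantified variables are supplied one at a time,
  -- updating μ at the next quantified variable to κ's value.
  ∃⃗-intro : {n k : ℕ} (v : Fin k → Fin n) (u : Formula S E n) (μ κ : Pt n) →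
            AgreeOff v κ μ → κ ⊨ u → μ ⊨ ∃⃗ v u
  ∃⃗-intro {k = zero}  v u μ κ κ≈μ κ⊨u = val-resp-vars u κ μ (λ z → κ≈μ z (λ ())) κ⊨u
  ∃⃗-intro {k = suc k} v u μ κ κ≈μ κ⊨u =
    μ₁ , (λ y y≢v₀ → update-off (v zero) _ _ y y≢v₀) , ∃⃗-intro (v ∘ suc) u μ₁ κ κ≈μ₁ κ⊨u
    where
    μ₁ : Pt _
    μ₁ = pointOf E H∈Θ (update (v zero) (fun κ ∘ var) (fun μ ∘ var))
    κ≈μ₁ : AgreeOff (v ∘ suc) κ μ₁
    κ≈μ₁ z z∉v = by-cases (z ≟ v zero)
      where
      by-cases : Dec (z ≡ v zero) → fun κ (var z) ≈ fun μ₁ (var z)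
      by-cases (yes ≡.refl) = sym (update-at (v zero) _ _)
      by-cases (no  z≢v₀)   = trans (κ≈μ z λ { zero → z≢v₀ ; (suc j) → z∉v j })
                                    (sym (update-off (v zero) _ _ z z≢v₀))

  ⋀ : {n k : ℕ} → (Fin (suc k) → Formula S E n) → Formula S E n
  ⋀ {k = zero}  F = F zero
  ⋀ {k = suc k} F = F zero ∧ᶠ ⋀ (F ∘ suc)

  ⋀-elim : {n k : ℕ} (F : Fin (suc k) → Formula S E n) (μ : Pt n) → μ ⊨ ⋀ F → ∀ i → μ ⊨ F i
  ⋀-elim {k = zero}  F μ h       zero    = h
  ⋀-elim {k = suc k} F μ (h , _) zero    = h
  ⋀-elim {k = suc k} F μ (_ , h) (suc i) = ⋀-elim (F ∘ suc) μ h i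

  ⋀-intro : {n k : ℕ} (F : Fin (suc k) → Formula S E n) (μ : Pt n) → (∀ i → μ ⊨ F i) → μ ⊨ ⋀ F
  ⋀-intro {k = zero}  F μ h = h zero
  ⋀-intro {k = suc k} F μ h = h zero , ⋀-intro (F ∘ suc) μ (h ∘ suc)

  -- The image formula of terms t₀,…,tₙ₋₁ in m variables,
  --   ∃ y₀ … yₘ₋₁ ⋀ᵢ xᵢ ≡ tᵢ(y),
  -- written in sort n + m (yⱼ is the variable x_{n+j}) and pulled back to
  -- sort n: a point satisfies it iff its values are tᵢ(c) for a common c.
  module ImageFormula {n' m : ℕ} (t : Fin (suc n') → Term S (Fin m)) where
    open Substitution S E
    open SetoidReasoning (setoidOf H)

    y : Fin m → Fin (suc n' + m)
    y j = suc n' ↑ʳ j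

    equations : Formula S E (suc n' + m)
    equations = ⋀ λ i → var (i ↑ˡ m) ≐ bind (var ∘ y) (t i)

    -- W(n + m) → W(n) fixing x₀,…,xₙ₋₁; the bound yⱼ may be sent anywhere.
    restrict : Hom S (W S E (suc n' + m)) (W S E (suc n'))
    restrict = substHom (var ++ λ _ → var zero)

    image : Formula S E (suc n')
    image = restrict *ᶠ ∃⃗ y equations

    restrict-x : (μ : Pt (suc n')) (i : Fin (suc n')) →
                 fun (_∘ₕ_ S μ restrict) (var (i ↑ˡ m)) ≡ fun μ (var i)
    restrict-x μ i = ≡.cong (fun μ) (lookup-++ˡ var _ i)

    -- Witness: the yⱼ take the values cⱼ.
    image-intro : (μ : Pt (suc n')) (c : Fin m → Carrier) →
                  (∀ i → fun μ (var i) ≈ eval S H c (t i)) → μ ⊨ image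
    image-intro μ c μ≈t[c] = ∃⃗-intro y equations (_∘ₕ_ S μ restrict) κ κ≈μ κ⊨equations
      where
      ρ : Fin (suc n' + m) → Carrier
      ρ = (fun μ ∘ var) ++ c
      κ : Pt (suc n' + m)
      κ = pointOf E H∈Θ ρ
      κ≈μ : AgreeOff y κ (_∘ₕ_ S μ restrict)
      κ≈μ z z∉y with ↑-cases {suc n'} {m} z
      ... | inj₁ (i , ≡.refl) = reflexive (≡.trans (lookup-++ˡ (fun μ ∘ var) c i) (≡.sym (restrict-x μ i)))
      ... | inj₂ (j , ≡.refl) = ⊥-elim (z∉y j ≡.refl)
      κ⊨equations : κ ⊨ equations
      κ⊨equations = ⋀-intro _ κ λ i → begin
        ρ (i ↑ˡ m)                   ≡⟨ lookup-++ˡ (fun μ ∘ var) c i ⟩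
        fun μ (var i)                ≈⟨ μ≈t[c] i ⟩
        eval S H c (t i)             ≈⟨ eval-cong H (λ j → reflexive (≡.sym (lookup-++ʳ (fun μ ∘ var) c j))) (t i) ⟩
        eval S H (ρ ∘ y) (t i)       ≈⟨ sym (point-eval E (_∘ₕ_ S κ (substHom (var ∘ y))) (t i)) ⟩
        fun κ (bind (var ∘ y) (t i)) ∎

    -- The values of the yⱼ in a witness form a common preimage.
    image-elim : (μ : Pt (suc n')) → μ ⊨ image →
                 Σ (Fin m → Carrier) λ c → ∀ i → fun μ (var i) ≈ eval S H c (t i)
    image-elim μ μ⊨image = preimage (∃⃗-elim y equations (_∘ₕ_ S μ restrict) μ⊨image)
      where
      preimage : Σ (Pt (suc n' + m)) (λ κ → AgreeOff y κ (_∘ₕ_ S μ restrict) × κ ⊨ equations) →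
                 Σ (Fin m → Carrier) λ c → ∀ i → fun μ (var i) ≈ eval S H c (t i)
      preimage (κ , κ≈μ , κ⊨equations) = fun κ ∘ var ∘ y , λ i → begin
        fun μ (var i)                          ≡⟨ ≡.sym (restrict-x μ i) ⟩
        fun (_∘ₕ_ S μ restrict) (var (i ↑ˡ m)) ≈⟨ sym (κ≈μ (i ↑ˡ m) (↑ˡ≢↑ʳ i)) ⟩
        fun κ (var (i ↑ˡ m))                   ≈⟨ ⋀-elim _ κ κ⊨equations i ⟩
        fun κ (bind (var ∘ y) (t i))           ≈⟨ point-eval E (_∘ₕ_ S κ (substHom (var ∘ y))) (t i) ⟩
        eval S H (fun κ ∘ var ∘ y) (t i)       ∎

  module Endomorphisms {m : ℕ} (gen : Fin m → Carrier)
      (generated : ∀ x → Σ (Term S (Fin m)) λ t → x ≈ eval S H gen t)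
      (extend : (c : Fin m → Carrier) → Σ (Hom S H H) λ e → ∀ j → fun e (gen j) ≈ c j) where
    open SetoidReasoning (setoidOf H)

    on-variables : {n : ℕ} (e : Hom S H H) (μ ν : Pt n) →
                   (∀ x → fun e (fun μ (var x)) ≈ fun ν (var x)) → ∀ w → fun e (fun μ w) ≈ fun ν w
    on-variables e μ ν e∘μ≈ν w = begin
      fun e (fun μ w)                     ≈⟨ cong e (point-eval E μ w) ⟩
      fun e (eval S H (fun μ ∘ var) w)    ≈⟨ hom-eval e (fun μ ∘ var) w ⟩
      eval S H (fun e ∘ fun μ ∘ var) w    ≈⟨ eval-cong H e∘μ≈ν w ⟩
      eval S H (fun ν ∘ var) w            ≈⟨ sym (point-eval E ν w) ⟩
      fun ν w                             ∎

    -- With no variables the points agree and the identity works.  Otherwise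
    -- μ satisfies the image formula of the terms tᵢ with μ(xᵢ) = tᵢ(gen),
    -- hence so does ν, giving c with ν(xᵢ) = tᵢ(c); take e : gen ↦ c.
    kernel⇒endomorphism : {n : ℕ} (μ ν : Pt n) → (∀ u → μ ⊨ u → ν ⊨ u) →
                          Σ (Hom S H H) λ e → ∀ w → fun e (fun μ w) ≈ fun ν w
    kernel⇒endomorphism {zero}   μ ν _   = idHom H , on-variables (idHom H) μ ν (λ ())
    kernel⇒endomorphism {suc n'} μ ν μ⊆ν = e , on-variables e μ ν e∘μ≈ν
      where
      t : Fin (suc n') → Term S (Fin m)
      t i = proj₁ (generated (fun μ (var i)))
      μ≈t[gen] : ∀ i → fun μ (var i) ≈ eval S H gen (t i)
      μ≈t[gen] i = proj₂ (generated (fun μ (var i)))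
      open ImageFormula t
      ν-preimage : Σ (Fin m → Carrier) λ c → ∀ i → fun ν (var i) ≈ eval S H c (t i)
      ν-preimage = image-elim ν (μ⊆ν image (image-intro μ gen μ≈t[gen]))
      c : Fin m → Carrier
      c = proj₁ ν-preimage
      e : Hom S H H
      e = proj₁ (extend c)
      e∘μ≈ν : ∀ i → fun e (fun μ (var i)) ≈ fun ν (var i)
      e∘μ≈ν i = begin
        fun e (fun μ (var i))        ≈⟨ cong e (μ≈t[gen] i) ⟩
        fun e (eval S H gen (t i))   ≈⟨ hom-eval e gen (t i) ⟩
        eval S H (fun e ∘ gen) (t i) ≈⟨ eval-cong H (proj₂ (extend c)) (t i) ⟩
        eval S H c (t i)             ≈⟨ sym (proj₂ ν-preimage i) ⟩
        fun ν (var i)                ∎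

  _≼_ : {k : ℕ} → (Fin k → Carrier) → (Fin k → Carrier) → Set
  _≼_ {k} g h = ∀ (t t' : Term S (Fin k)) → eval S H g t ≈ eval S H g t' → eval S H h t ≈ eval S H h t'

  kernel⇒≼ : {n : ℕ} (μ ν : Pt n) → (∀ u → μ ⊨ u → ν ⊨ u) → (fun μ ∘ var) ≼ (fun ν ∘ var)
  kernel⇒≼ μ ν μ⊆ν t t' μt≈μt' =
    trans (sym (point-eval E ν t))
          (trans (μ⊆ν (t ≐ t') (trans (point-eval E μ t) (trans μt≈μt' (sym (point-eval E μ t')))))
                 (point-eval E ν t'))

  module _ {k : ℕ} (g h : Fin k → Carrier) where

    termHom : g ≼ h → Hom S (SubAlg S H g) (SubAlg S H h)
    termHom g≼h = record
      { fun  = λ { (_ , t , _) → eval S H h t , t , refl }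
      ; cong = λ { {_ , t , a≈t[g]} {_ , t' , a'≈t'[g]} a≈a' →
                   g≼h t t' (trans (sym a≈t[g]) (trans a≈a' a'≈t'[g])) }
      ; homo = λ f as → refl
      }

    termHom-extension : (g≼h : g ≼ h) (e : Hom S H H) → (∀ i → fun e (g i) ≈ h i) →
                        ∀ a → fun e (proj₁ a) ≈ proj₁ (fun (termHom g≼h) a)
    termHom-extension g≼h e e∘g≈h (_ , t , a≈t[g]) =
      trans (cong e a≈t[g]) (trans (hom-eval e g t) (eval-cong H e∘g≈h t))

  termIso : {k : ℕ} (g h : Fin k → Carrier) → g ≼ h → h ≼ g → Iso S (SubAlg S H g) (SubAlg S H h)
  termIso g h g≼h h≼g = record
    { to      = termHom g h g≼h
    ; from    = termHom h g h≼g
    ; to-from = λ { (_ , _ , b≈t[h]) → sym b≈t[h] }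
    ; from-to = λ { (_ , _ , a≈t[g]) → sym a≈t[g] }
    }

theorem4p2 : (S : Signature) (E : Identities S) (H : Algebra S) →
    IsFreeFinitelyGenerated S E H → WeaklyHomogeneous S H → LogicallyPerfect S E H
theorem4p2 S E H (H∈Θ , m , gen , universal) weaklyHomogeneous n μ ν sameLKer = α , μ≈α∘ν
  where
  open FreeAlgebra S E H H∈Θ gen universal
  open Semantics S E H H∈Θ
  open Endomorphisms gen generated extend
  open Evaluation S using (point-eval)
  open Setoid (setoidOf H) using (Carrier; _≈_; refl; sym)
  open SetoidReasoning (setoidOf H)
  μ⊆ν : ∀ u → μ ⊨ u → ν ⊨ u
  μ⊆ν u = proj₁ (sameLKer u)
  ν⊆μ : ∀ u → ν ⊨ u → μ ⊨ u
  ν⊆μ u = proj₂ (sameLKer u)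
  a b : Fin n → Carrier
  a = Hom.fun μ ∘ var
  b = Hom.fun ν ∘ var
  b≼a : b ≼ a
  b≼a = kernel⇒≼ ν μ ν⊆μ
  a≼b : a ≼ b
  a≼b = kernel⇒≼ μ ν μ⊆ν
  -- e extends φ : Sg(b) ≅ Sg(a), t(b) ↦ t(a), and e' extends φ⁻¹.
  e : Σ (Hom S H H) λ f → ∀ w → Hom.fun f (Hom.fun ν w) ≈ Hom.fun μ w
  e = kernel⇒endomorphism ν μ ν⊆μ
  e' : Σ (Hom S H H) λ f → ∀ w → Hom.fun f (Hom.fun μ w) ≈ Hom.fun ν w
  e' = kernel⇒endomorphism μ ν μ⊆ν
  α-spec : Σ (Aut S H) λ α → ∀ x → Hom.fun (Iso.to α) (proj₁ x) ≈ proj₁ (Hom.fun (termHom b a b≼a) x)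
  α-spec = weaklyHomogeneous b a (termIso b a b≼a a≼b)
    (proj₁ e  , termHom-extension b a b≼a (proj₁ e) (proj₂ e ∘ var))
    (proj₁ e' , termHom-extension a b a≼b (proj₁ e') (proj₂ e' ∘ var))
  α : Aut S H
  α = proj₁ α-spec
  μ≈α∘ν : ∀ w → Hom.fun μ w ≈ Hom.fun (Iso.to α) (Hom.fun ν w)
  μ≈α∘ν w = begin
    Hom.fun μ w                              ≈⟨ point-eval E μ w ⟩
    eval S H a w                             ≈⟨ sym (proj₂ α-spec (eval S H b w , w , refl)) ⟩
    Hom.fun (Iso.to α) (eval S H b w)        ≈⟨ Hom.cong (Iso.to α) (sym (point-eval E ν w)) ⟩
    Hom.fun (Iso.to α) (Hom.fun ν w)         ∎
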